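{- Let $a,b,k$ be integers with $k\ge b>a\ge1$. For $m\ge1$ let $\mathcal{BR}'_{a,b,k}(m)$ be the set of partitions $\lambda=(\lambda_1,\dots,\lambda_m)$ with exactly $m$ parts, all parts congruent to $a$ or $b$ modulo $k$, only parts congruent to $b$ modulo $k$ repeated, such that $\lambda_m\in\{a,b\}$ and, for $1\le i<m$, $\lambda_i-\lambda_{i+1}\le k$ with strict inequality if $\lambda_{i+1}\equiv b\pmod k$. Then for $m\ge1$, \[\sum_{\lambda\in\mathcal{BR}'_{a,b,k}(m)}u^{\ell_a(\lambda)}v^{\ell_b(\lambda)}q^{|\lambda|}=\sum_{h=0}^m u^hv^{m-h}q^{mb+k\binom h2+(a-b)h}{m\brack h}_k.\]
   Context: A partition is a finite non-increasing sequence of positive integers; $|\lambda|$ is the sum of its parts; $\ell_a(\lambda)$, $\ell_b(\lambda)$ are the numbers of parts congruent to $a$, resp. $b$, modulo $k$. $(x;q)_n=\prod_{i=0}^{n-1}(1-xq^i)$, and ${A\brack B}_k=\frac{(q^k;q^k)_A}{(q^k;q^k)_B(q^k;q^k)_{A-B}}$ for $A\ge B\ge0$, $0$ otherwise. -}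

module Defs where

open import Data.Nat as ℕ using (ℕ; zero; suc; NonZero; _≤_; _<_)
open import Data.Nat.DivMod using (_%_)
open import Data.Nat.Combinatorics using (_C_)
open import Data.List using (List; []; _∷_; length; filter; foldr; map; last; upTo)
open import Data.List.Relation.Unary.All using (All)
open import Data.List.Relation.Unary.Linked using (Linked)
open import Data.Maybe using (just)
open import Data.Product using (_×_)
open import Data.Sum using (_⊎_)
open import Relation.Binary.PropositionalEquality using (_≡_; _≢_)
open import Relation.Nullary using (yes; no)
open import Data.Rational as ℚ using (ℚ; 0ℚ; 1ℚ; _+_; _*_; _-_; _÷_; ≢-nonZero)
open import Data.Rational.Properties using (_≟_)

_^ℚ_ : ℚ → ℕ → ℚ
x ^ℚ zero  = 1ℚ
x ^ℚ suc n = x * (x ^ℚ n)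

-- total division: x ÷ y when y ≠ 0, and 0 otherwise
-- (only ever used where the denominator is nonzero under the hypotheses)
divℚ : ℚ → ℚ → ℚ
divℚ x y with y ≟ 0ℚ
... | yes _  = 0ℚ
... | no y≢0 = _÷_ x y {{≢-nonZero y≢0}}

sumTo : ℕ → (ℕ → ℚ) → ℚ
sumTo m f = foldr _+_ 0ℚ (map f (upTo (suc m)))

sumℚ : List ℚ → ℚ
sumℚ = foldr _+_ 0ℚ

poch : ℚ → ℚ → ℕ → ℚ
poch x p zero    = 1ℚ
poch x p (suc n) = poch x p n * (1ℚ - x * (p ^ℚ n))

qbinom : ℕ → ℚ → ℕ → ℕ → ℚ
qbinom k q A B with B ℕ.≤? A
... | yes _ = divℚ (poch (q ^ℚ k) (q ^ℚ k) A)
                   (poch (q ^ℚ k) (q ^ℚ k) B * poch (q ^ℚ k) (q ^ℚ k) (A ℕ.∸ B))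
... | no _  = 0ℚ

IsPartition : List ℕ → Set
IsPartition λs = All (λ x → 1 ≤ x) λs × Linked (λ x y → y ≤ x) λs

size : List ℕ → ℕ
size = foldr ℕ._+_ 0

Cong : (k : ℕ) .{{_ : NonZero k}} → ℕ → ℕ → Set
Cong k x y = x % k ≡ y % k

ℓ : (k : ℕ) .{{_ : NonZero k}} → ℕ → List ℕ → ℕ
ℓ k r λs = length (filter (λ x → x % k ℕ.≟ r % k) λs)

mult : ℕ → List ℕ → ℕ
mult x λs = length (filter (λ y → y ℕ.≟ x) λs)

Gap : (k : ℕ) .{{_ : NonZero k}} → ℕ → ℕ → ℕ → Set
Gap k b x y = (x ≤ y ℕ.+ k) × (Cong k y b → x < y ℕ.+ k)

BR' : (a b k : ℕ) .{{_ : NonZero k}} → ℕ → List ℕ → Set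
BR' a b k m λs =
  IsPartition λs
  × length λs ≡ m
  × All (λ x → Cong k x a ⊎ Cong k x b) λs
  × (∀ x → Cong k x a → mult x λs ≤ 1)
  × (last λs ≡ just a ⊎ last λs ≡ just b)
  × Linked (Gap k b) λs

weight : (a b k : ℕ) .{{_ : NonZero k}} → ℚ → ℚ → ℚ → List ℕ → ℚ
weight a b k u v q λs = (u ^ℚ ℓ k a λs) * (v ^ℚ ℓ k b λs) * (q ^ℚ size λs)

-- exponent m b + k (h choose 2) + (a - b) h, as a natural number
-- (it is always ≥ 0 for 0 ≤ h ≤ m and a < b, so the truncated ∸ is exact)
rhsExp : (a b k m h : ℕ) → ℕ
rhsExp a b k m h = (m ℕ.* b ℕ.+ k ℕ.* (h C 2)) ℕ.∸ ((b ℕ.∸ a) ℕ.* h)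

rhs : (a b k m : ℕ) → ℚ → ℚ → ℚ → ℚ
rhs a b k m u v q =
  sumTo m (λ h → (u ^ℚ h) * (v ^ℚ (m ℕ.∸ h)) * (q ^ℚ rhsExp a b k m h) * qbinom k q m h)

{-# OPTIONS --safe #-}

-- Write each part of a partition in BR'_{a,b,k}(m) as r + k·c with r ∈ {a, b}. The gap
-- conditions leave no freedom in c: reading the parts upwards from the second smallest, c is
-- the number of parts ≡ a read so far, while the smallest part is a or b itself. These
-- partitions are therefore in bijection with the words over {α, β} of length m, and summing
-- the weights letter by letter gives (x + y)(xp + y) ⋯ (xp^(m-1) + y) for x = u q^a,
-- y = v q^b, p = q^k. The q-binomial theorem expands this product as
-- Σ_h x^h y^(m-h) p^C(h,2) [m h]_p, which is the right-hand side. The Gaussian binomial is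
-- handled through its q-Pascal recursion and identified with the quotient of q-factorials
-- only at the end, where q^(ki) ≠ 1 keeps the denominators nonzero.

module Submission where

open import Defs
open import Data.Nat as ℕ using (ℕ; NonZero; _≤_; _<_; _*_; zero; suc; _∸_; z≤n; s≤s)
import Data.Nat.Properties as ℕ
open import Data.Nat.Combinatorics using (_C_; nC1≡n; nCk+nC[k+1]≡[n+1]C[k+1])
open import Data.Nat.DivMod using (_%_; _/_; m≡m%n+[m/n]*n; m<n⇒m%n≡m; n%n≡0; [m+kn]%n≡m%n)
open import Data.Nat.Tactic.RingSolver using (solve-∀)
open import Data.Fin using (toℕ)
open import Data.Fin.Properties using (toℕ<n)
open import Data.List
  using (List; []; _∷_; _++_; map; length; last; applyUpTo; cartesianProductWith)
import Data.List.Properties as List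
open import Data.List.Membership.Propositional using (_∈_)
open import Data.List.Membership.Propositional.Properties
  using (∈-map⁺; ∈-map⁻; ∈-cartesianProductWith⁺; ∈-cartesianProductWith⁻)
open import Data.List.Membership.Propositional.Properties.WithK using (unique∧set⇒bag)
open import Data.List.Relation.Unary.Any using (here; there)
open import Data.List.Relation.Unary.All as All using (All; []; _∷_)
open import Data.List.Relation.Unary.AllPairs using ([]; _∷_)
open import Data.List.Relation.Unary.Linked using (Linked; []; [-]; _∷_)
open import Data.List.Relation.Unary.Unique.Propositional using (Unique)
import Data.List.Relation.Unary.Unique.Propositional.Properties as Unique
open import Data.List.Relation.Binary.Permutation.Propositional using (_↭_; ↭⇒↭ₛ)
import Data.List.Relation.Binary.Permutation.Propositional.Properties as ↭
open import Data.List.Relation.Binary.Permutation.Setoid.Properties using (foldr-commMonoid)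
open import Data.List.Relation.Binary.BagAndSetEquality using (∼bag⇒↭)
open import Data.Maybe using (just)
open import Data.Maybe.Properties using (just-injective)
open import Data.Rational using (ℚ; 0ℚ; 1ℚ; _+_; _-_; 1/_; ≢-nonZero) renaming (_*_ to _·_)
import Data.Rational.Properties as ℚ
open import Data.Rational.Solver using (module +-*-Solver)
open import Data.Product using (∃; ∃₂; _×_; _,_)
open import Data.Sum using (_⊎_; inj₁; inj₂)
open import Data.Empty using (⊥-elim)
open import Function using (_∘_; id)
open import Function.Bundles using (_⇔_; mk⇔)
open import Function.Construct.Symmetry using (⇔-sym)
open import Function.Construct.Composition using (_⇔-∘_)
open import Relation.Nullary using (yes; no)
open import Relation.Binary.PropositionalEquality
open import Algebra.Bundles using (CommutativeRing)

open +-*-Solver using (solve; _:=_; _:+_; _:*_; _:-_; con)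

module ℚ-Semiring = CommutativeRing ℚ.+-*-commutativeRing
open import Algebra.Properties.Semiring.Exp ℚ-Semiring.semiring as Exp using (_^_)
open import Algebra.Properties.CommutativeSemiring.Exp ℚ-Semiring.commutativeSemiring
  using (^-distrib-*)
open import Algebra.Properties.Semiring.Sum ℚ-Semiring.semiring
  using (sum-syntax; sum-cong-≗; ∑-distrib-+; *-distribˡ-sum)

^ℚ≡^ : ∀ x n → x ^ℚ n ≡ x ^ n
^ℚ≡^ x zero    = refl
^ℚ≡^ x (suc n) = cong (x ·_) (^ℚ≡^ x n)

^ℚ-+ : ∀ x m n → x ^ℚ (m ℕ.+ n) ≡ x ^ℚ m · x ^ℚ n
^ℚ-+ x m n rewrite ^ℚ≡^ x (m ℕ.+ n) | ^ℚ≡^ x m | ^ℚ≡^ x n = Exp.^-homo-* x m n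

^ℚ-* : ∀ x m n → x ^ℚ (m * n) ≡ (x ^ℚ m) ^ℚ n
^ℚ-* x m n rewrite ^ℚ≡^ x (m * n) | ^ℚ≡^ (x ^ℚ m) n | ^ℚ≡^ x m = sym (Exp.^-assocʳ x m n)

^ℚ-distrib-· : ∀ x y n → (x · y) ^ℚ n ≡ x ^ℚ n · y ^ℚ n
^ℚ-distrib-· x y n rewrite ^ℚ≡^ (x · y) n | ^ℚ≡^ x n | ^ℚ≡^ y n = ^-distrib-* x y n

·-≢0 : ∀ {x y} → x ≢ 0ℚ → y ≢ 0ℚ → x · y ≢ 0ℚ
·-≢0 {x} {y} x≢0 y≢0 xy≡0 = y≢0 (begin
  y               ≡⟨ ℚ.*-identityˡ y ⟨
  1ℚ · y          ≡⟨ cong (_· y) (ℚ.*-inverseˡ x) ⟨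
  (1/ x) · x · y  ≡⟨ ℚ.*-assoc (1/ x) x y ⟩
  1/ x · (x · y)  ≡⟨ cong (1/ x ·_) xy≡0 ⟩
  1/ x · 0ℚ       ≡⟨ ℚ.*-zeroʳ (1/ x) ⟩
  0ℚ              ∎)
  where
  open ≡-Reasoning
  instance _ = ≢-nonZero x≢0

divℚ-· : ∀ x y → y ≢ 0ℚ → divℚ (x · y) y ≡ x
divℚ-· x y y≢0 with y ℚ.≟ 0ℚ
... | yes y≡0 = ⊥-elim (y≢0 y≡0)
... | no y≢0′ = begin
  x · y · 1/ y    ≡⟨ ℚ.*-assoc x y (1/ y) ⟩
  x · (y · 1/ y)  ≡⟨ cong (x ·_) (ℚ.*-inverseʳ y) ⟩
  x · 1ℚ          ≡⟨ ℚ.*-identityʳ x ⟩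
  x               ∎
  where
  open ≡-Reasoning
  instance _ = ≢-nonZero y≢0′

1-x≢0 : ∀ {x} → x ≢ 1ℚ → 1ℚ - x ≢ 0ℚ
1-x≢0 {x} x≢1 1-x≡0 = x≢1 (begin
  x                 ≡⟨ solve 1 (λ x → x := con 1ℚ :- (con 1ℚ :- x)) refl x ⟩
  1ℚ - (1ℚ - x)     ≡⟨ cong (1ℚ -_) 1-x≡0 ⟩
  1ℚ                ∎)
  where open ≡-Reasoning

sum-drop-zero-last : ∀ n (f : ℕ → ℚ) → f n ≡ 0ℚ → ∑[ i < suc n ] f (toℕ i) ≡ ∑[ i < n ] f (toℕ i)
sum-drop-zero-last zero    f fn≡0 = cong (_+ 0ℚ) fn≡0
sum-drop-zero-last (suc n) f fn≡0 = cong (f 0 +_) (sum-drop-zero-last n (λ i → f (suc i)) fn≡0)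

sumℚ-map-applyUpTo : ∀ n (g : ℕ → ℕ) (f : ℕ → ℚ) →
                     sumℚ (map f (applyUpTo g n)) ≡ ∑[ i < n ] f (g (toℕ i))
sumℚ-map-applyUpTo zero    g f = refl
sumℚ-map-applyUpTo (suc n) g f = cong (f (g 0) +_) (sumℚ-map-applyUpTo n (λ i → g (suc i)) f)

sumℚ-map-++ : ∀ {A : Set} (f : A → ℚ) xs ys →
              sumℚ (map f (xs ++ ys)) ≡ sumℚ (map f xs) + sumℚ (map f ys)
sumℚ-map-++ f []       ys = sym (ℚ.+-identityˡ _)
sumℚ-map-++ f (x ∷ xs) ys = trans (cong (f x +_) (sumℚ-map-++ f xs ys)) (sym (ℚ.+-assoc (f x) _ _))

sumℚ-map-·ˡ : ∀ {A : Set} c (f : A → ℚ) xs → sumℚ (map (λ z → c · f z) xs) ≡ c · sumℚ (map f xs)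
sumℚ-map-·ˡ c f []       = sym (ℚ.*-zeroʳ c)
sumℚ-map-·ˡ c f (x ∷ xs) =
  trans (cong (c · f x +_) (sumℚ-map-·ˡ c f xs)) (sym (ℚ.*-distribˡ-+ c _ _))

sumℚ-↭ : ∀ {xs ys} → xs ↭ ys → sumℚ xs ≡ sumℚ ys
sumℚ-↭ xs↭ys = foldr-commMonoid (setoid ℚ) ℚ.+-0-isCommutativeMonoid (↭⇒↭ₛ xs↭ys)

sumℚ-map-unique : ∀ {A : Set} (f : A → ℚ) {xs ys} → Unique xs → Unique ys →
                  (∀ z → z ∈ xs ⇔ z ∈ ys) → sumℚ (map f xs) ≡ sumℚ (map f ys)
sumℚ-map-unique f xs! ys! same =
  sumℚ-↭ (↭.map⁺ f (∼bag⇒↭ (unique∧set⇒bag xs! ys! (λ {z} → same z))))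

module Gaussian (p : ℚ) where

  gaussian : ℕ → ℕ → ℚ
  gaussian m       zero    = 1ℚ
  gaussian zero    (suc h) = 0ℚ
  gaussian (suc m) (suc h) = gaussian m h + p ^ℚ suc h · gaussian m (suc h)

  gaussian-vanishes : ∀ {m h} → m < h → gaussian m h ≡ 0ℚ
  gaussian-vanishes {zero}  {suc h} _ = refl
  gaussian-vanishes {suc m} {suc h} (s≤s m<h)
    rewrite gaussian-vanishes m<h | gaussian-vanishes (ℕ.m<n⇒m<1+n m<h) =
    trans (ℚ.+-identityˡ _) (ℚ.*-zeroʳ (p ^ℚ suc h))

  gaussian-diagonal : ∀ m → gaussian m m ≡ 1ℚ
  gaussian-diagonal zero = refl
  gaussian-diagonal (suc m)
    rewrite gaussian-diagonal m | gaussian-vanishes (ℕ.n<1+n m) | ℚ.*-zeroʳ (p ^ℚ suc m) = refl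

  [_]! : ℕ → ℚ
  [ n ]! = poch p p n

  gaussian-·-factorials : ∀ h d → gaussian (h ℕ.+ d) h · ([ h ]! · [ d ]!) ≡ [ h ℕ.+ d ]!
  gaussian-·-factorials zero d = trans (ℚ.*-identityˡ _) (ℚ.*-identityˡ _)
  gaussian-·-factorials (suc h) zero rewrite ℕ.+-identityʳ h | gaussian-diagonal (suc h) =
    trans (ℚ.*-identityˡ _) (ℚ.*-identityʳ _)
  gaussian-·-factorials (suc h) (suc d) = begin
    (G₀ + P · G₁) · ([ h ]! · (1ℚ - P) · ([ d ]! · (1ℚ - D)))
      ≡⟨ solve 6 (λ G₀ G₁ P D H E →
            (G₀ :+ P :* G₁) :* (H :* (con 1ℚ :- P) :* (E :* (con 1ℚ :- D)))
            := G₀ :* (H :* (E :* (con 1ℚ :- D))) :* (con 1ℚ :- P)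
               :+ P :* (con 1ℚ :- D) :* (G₁ :* (H :* (con 1ℚ :- P) :* E)))
          refl G₀ G₁ P D [ h ]! [ d ]! ⟩
    G₀ · ([ h ]! · [ suc d ]!) · (1ℚ - P) + P · (1ℚ - D) · (G₁ · ([ suc h ]! · [ d ]!))
      ≡⟨ cong₂ (λ s t → s · (1ℚ - P) + P · (1ℚ - D) · t)
           (gaussian-·-factorials h (suc d)) shifted ⟩
    [ m ]! · (1ℚ - P) + P · (1ℚ - D) · [ m ]!
      ≡⟨ solve 3 (λ F P D → F :* (con 1ℚ :- P) :+ P :* (con 1ℚ :- D) :* F
                            := F :* (con 1ℚ :- P :* D)) refl [ m ]! P D ⟩
    [ m ]! · (1ℚ - P · D)
      ≡⟨ cong (λ z → [ m ]! · (1ℚ - z)) (^ℚ-+ p (suc h) (suc d)) ⟨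
    [ suc m ]! ∎
    where
    open ≡-Reasoning
    m : ℕ
    m  = h ℕ.+ suc d
    G₀ G₁ P D : ℚ
    G₀ = gaussian m h
    G₁ = gaussian m (suc h)
    P  = p ^ℚ suc h
    D  = p ^ℚ suc d
    shifted : G₁ · ([ suc h ]! · [ d ]!) ≡ [ m ]!
    shifted = subst (λ n → gaussian n (suc h) · ([ suc h ]! · [ d ]!) ≡ [ n ]!)
                    (sym (ℕ.+-suc h d)) (gaussian-·-factorials (suc h) d)

  factorial-≢0 : ∀ n → (∀ i → 1 ≤ i → i ≤ n → p ^ℚ i ≢ 1ℚ) → [ n ]! ≢ 0ℚ
  factorial-≢0 zero    _ ()
  factorial-≢0 (suc n) H = ·-≢0 (factorial-≢0 n (λ i 1≤i i≤n → H i 1≤i (ℕ.m≤n⇒m≤1+n i≤n)))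
                                (1-x≢0 (H (suc n) (s≤s z≤n) ℕ.≤-refl))

open Gaussian using (gaussian; gaussian-vanishes)

qbinom≡gaussian : ∀ k q {m h} → (∀ i → 1 ≤ i → i ≤ m → (q ^ℚ k) ^ℚ i ≢ 1ℚ) → h ≤ m →
                  qbinom k q m h ≡ gaussian (q ^ℚ k) m h
qbinom≡gaussian k q {m} {h} H h≤m with h ℕ.≤? m
... | no h≰m = ⊥-elim (h≰m h≤m)
... | yes _  = begin
  divℚ [ m ]! ([ h ]! · [ m ∸ h ]!)
    ≡⟨ cong (λ n → divℚ n ([ h ]! · [ m ∸ h ]!)) factorisation ⟨
  divℚ (gaussian p m h · ([ h ]! · [ m ∸ h ]!)) ([ h ]! · [ m ∸ h ]!)
    ≡⟨ divℚ-· _ _ (·-≢0 (factorial-≢0 h (below h≤m)) (factorial-≢0 (m ∸ h) (below (ℕ.m∸n≤m m h)))) ⟩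
  gaussian p m h ∎
  where
  open ≡-Reasoning
  p : ℚ
  p = q ^ℚ k
  open Gaussian p using ([_]!; gaussian-·-factorials; factorial-≢0)
  below : ∀ {n} → n ≤ m → ∀ i → 1 ≤ i → i ≤ n → p ^ℚ i ≢ 1ℚ
  below n≤m i 1≤i i≤n = H i 1≤i (ℕ.≤-trans i≤n n≤m)
  factorisation : gaussian p m h · ([ h ]! · [ m ∸ h ]!) ≡ [ m ]!
  factorisation = subst (λ n → gaussian p n h · ([ h ]! · [ m ∸ h ]!) ≡ [ n ]!)
                        (ℕ.m+[n∸m]≡n h≤m) (gaussian-·-factorials h (m ∸ h))

suc-C2 : ∀ h → suc h C 2 ≡ h ℕ.+ h C 2
suc-C2 h = trans (sym (nCk+nC[k+1]≡[n+1]C[k+1] h 1)) (cong (ℕ._+ h C 2) (nC1≡n h))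

module QBinomial (p y : ℚ) where

  binomialProduct : ℕ → ℚ → ℚ
  binomialProduct zero    x = 1ℚ
  binomialProduct (suc m) x = (x + y) · binomialProduct m (x · p)

  coefficient : ℕ → ℕ → ℚ
  coefficient m h = y ^ℚ (m ∸ h) · gaussian p m h

  binomialTerm : ℕ → ℚ → ℕ → ℚ
  binomialTerm m x h = x ^ℚ h · p ^ℚ (h C 2) · coefficient m h

  coefficient-pascal : ∀ m h →
    coefficient (suc m) (suc h) ≡ coefficient m h + p ^ℚ suc h · (y · coefficient m (suc h))
  coefficient-pascal m h with h ℕ.<? m
  ... | yes h<m rewrite ℕ.+-∸-assoc 1 h<m =
    solve 5 (λ y Y G₀ P G₁ → y :* Y :* (G₀ :+ P :* G₁) := y :* Y :* G₀ :+ P :* (y :* (Y :* G₁)))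
      refl y (y ^ℚ (m ∸ suc h)) (gaussian p m h) (p ^ℚ suc h) (gaussian p m (suc h))
  ... | no h≮m rewrite gaussian-vanishes p (s≤s (ℕ.≮⇒≥ h≮m)) =
    solve 5 (λ y Y Y′ G₀ P → Y :* (G₀ :+ P :* con 0ℚ) := Y :* G₀ :+ P :* (y :* (Y′ :* con 0ℚ)))
      refl y (y ^ℚ (m ∸ h)) (y ^ℚ (m ∸ suc h)) (gaussian p m h) (p ^ℚ suc h)

  term-pascal : ∀ m x h → binomialTerm (suc m) x (suc h)
              ≡ x · binomialTerm m (x · p) h + y · binomialTerm m (x · p) (suc h)
  term-pascal m x h
    rewrite coefficient-pascal m h | suc-C2 h | ^ℚ-+ p h (h C 2) | ^ℚ-distrib-· x p h =
    solve 8 (λ x X p P C c₀ y c₁ →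
      x :* X :* (P :* C) :* (c₀ :+ p :* P :* (y :* c₁))
      := x :* (X :* P :* C :* c₀) :+ y :* (x :* p :* (X :* P) :* (P :* C) :* c₁)) refl
      x (x ^ℚ h) p (p ^ℚ h) (p ^ℚ (h C 2)) (coefficient m h) y (coefficient m (suc h))

  term-zero : ∀ m x → binomialTerm (suc m) x 0 ≡ y · binomialTerm m (x · p) 0
  term-zero m x = solve 2 (λ y Y → con 1ℚ :* con 1ℚ :* (y :* Y :* con 1ℚ)
                                   := y :* (con 1ℚ :* con 1ℚ :* (Y :* con 1ℚ))) refl y (y ^ℚ m)

  term-vanishes : ∀ m x → binomialTerm m x (suc m) ≡ 0ℚ
  term-vanishes m x rewrite gaussian-vanishes p (ℕ.n<1+n m) | ℚ.*-zeroʳ (y ^ℚ (m ∸ suc m)) =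
    ℚ.*-zeroʳ (x ^ℚ suc m · p ^ℚ (suc m C 2))

  q-binomial : ∀ m x → binomialProduct m x ≡ ∑[ h < suc m ] binomialTerm m x (toℕ h)
  q-binomial zero    x = refl
  q-binomial (suc m) x = begin
    (x + y) · binomialProduct m (x · p)
      ≡⟨ cong ((x + y) ·_) (q-binomial m (x · p)) ⟩
    (x + y) · ∑[ h < suc m ] t (toℕ h)
      ≡⟨ ℚ.*-distribʳ-+ _ x y ⟩
    x · ∑[ h < suc m ] t (toℕ h) + y · ∑[ h < suc m ] t (toℕ h)
      ≡⟨ cong₂ _+_ (*-distribˡ-sum {suc m} x (t ∘ toℕ)) (*-distribˡ-sum {suc m} y (t ∘ toℕ)) ⟩
    Σx + (y · t 0 + ∑[ h < m ] (y · t (suc (toℕ h))))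
      ≡⟨ cong (λ s → Σx + (y · t 0 + s)) (sum-drop-zero-last m (λ h → y · t (suc h)) last≡0) ⟨
    Σx + (y · t 0 + Σy)
      ≡⟨ solve 3 (λ a b c → a :+ (b :+ c) := b :+ (a :+ c)) refl Σx (y · t 0) Σy ⟩
    y · t 0 + (Σx + Σy)
      ≡⟨ cong (y · t 0 +_) (∑-distrib-+ {suc m} (λ h → x · t (toℕ h)) (λ h → y · t (suc (toℕ h)))) ⟨
    y · t 0 + ∑[ h < suc m ] (x · t (toℕ h) + y · t (suc (toℕ h)))
      ≡⟨ cong₂ _+_ (term-zero m x) (sum-cong-≗ {suc m} (λ h → term-pascal m x (toℕ h))) ⟨
    ∑[ h < suc (suc m) ] binomialTerm (suc m) x (toℕ h) ∎
    where
    open ≡-Reasoning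
    t : ℕ → ℚ
    t = binomialTerm m (x · p)
    Σx Σy : ℚ
    Σx = ∑[ h < suc m ] (x · t (toℕ h))
    Σy = ∑[ h < suc m ] (y · t (suc (toℕ h)))
    last≡0 : y · t (suc m) ≡ 0ℚ
    last≡0 = trans (cong (y ·_) (term-vanishes m (x · p))) (ℚ.*-zeroʳ y)

data Kind : Set where
  α β : Kind

kinds : List Kind
kinds = α ∷ β ∷ []

nextIndex : Kind → ℕ → ℕ
nextIndex α i = suc i
nextIndex β i = i

index : List Kind → ℕ
index []      = 0
index (κ ∷ w) = nextIndex κ (index w)

words : ℕ → List (List Kind)
words zero    = [] ∷ []
words (suc n) = cartesianProductWith _∷_ kinds (words n)

∈-words : ∀ w → w ∈ words (length w)
∈-words []      = here refl
∈-words (κ ∷ w) = ∈-cartesianProductWith⁺ _∷_ (∈-kinds κ) (∈-words w)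
  where
  ∈-kinds : ∀ κ → κ ∈ kinds
  ∈-kinds α = here refl
  ∈-kinds β = there (here refl)

length-∈-words : ∀ n {w} → w ∈ words n → length w ≡ n
length-∈-words zero    (here refl) = refl
length-∈-words (suc n) w∈ with ∈-cartesianProductWith⁻ _∷_ kinds (words n) w∈
... | _ , w , _ , w∈′ , refl = cong suc (length-∈-words n w∈′)

words-unique : ∀ n → Unique (words n)
words-unique zero    = [] ∷ []
words-unique (suc n) =
  Unique.cartesianProductWith⁺ _∷_ List.∷-injective (((λ ()) ∷ []) ∷ [] ∷ []) (words-unique n)

module WordWeight (p y : ℚ) where

  open QBinomial p y using (binomialProduct)

  letter : ℚ → Kind → ℚ
  letter x α = x
  letter x β = y

  wordWeight : ℚ → List Kind → ℚ
  wordWeight x []      = 1ℚ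
  wordWeight x (κ ∷ w) = letter x κ · wordWeight (x · p) w

  letter-shift : ∀ x κ i → letter x κ · p ^ℚ nextIndex κ i ≡ letter (x · p) κ · p ^ℚ i
  letter-shift x α i = sym (ℚ.*-assoc x p (p ^ℚ i))
  letter-shift x β i = refl

  wordWeight-shift : ∀ x w → wordWeight (x · p) w ≡ p ^ℚ index w · wordWeight x w
  wordWeight-shift x []      = refl
  wordWeight-shift x (κ ∷ w) = begin
    letter (x · p) κ · wordWeight (x · p · p) w
      ≡⟨ cong (letter (x · p) κ ·_) (wordWeight-shift (x · p) w) ⟩
    letter (x · p) κ · (p ^ℚ index w · W)
      ≡⟨ ℚ.*-assoc (letter (x · p) κ) _ W ⟨
    letter (x · p) κ · p ^ℚ index w · W
      ≡⟨ cong (_· W) (letter-shift x κ (index w)) ⟨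
    letter x κ · p ^ℚ index (κ ∷ w) · W
      ≡⟨ solve 3 (λ l P W → l :* P :* W := P :* (l :* W)) refl (letter x κ) (p ^ℚ index (κ ∷ w)) W ⟩
    p ^ℚ index (κ ∷ w) · (letter x κ · W) ∎
    where
    open ≡-Reasoning
    W : ℚ
    W = wordWeight (x · p) w

  sum-wordWeight-∷ : ∀ x κ ws →
    sumℚ (map (wordWeight x) (map (κ ∷_) ws)) ≡ letter x κ · sumℚ (map (wordWeight (x · p)) ws)
  sum-wordWeight-∷ x κ ws =
    trans (cong sumℚ (sym (List.map-∘ ws))) (sumℚ-map-·ˡ (letter x κ) (wordWeight (x · p)) ws)

  sum-wordWeight : ∀ n x → sumℚ (map (wordWeight x) (words n)) ≡ binomialProduct n x
  sum-wordWeight zero    x = refl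
  sum-wordWeight (suc n) x = begin
    sumℚ (map (wordWeight x) (map (α ∷_) ws ++ map (β ∷_) ws ++ []))
      ≡⟨ sumℚ-map-++ (wordWeight x) (map (α ∷_) ws) _ ⟩
    Sα + sumℚ (map (wordWeight x) (map (β ∷_) ws ++ []))
      ≡⟨ cong (Sα +_) (sumℚ-map-++ (wordWeight x) (map (β ∷_) ws) []) ⟩
    Sα + (Sβ + 0ℚ)
      ≡⟨ cong₂ (λ s t → s + (t + 0ℚ)) (sum-wordWeight-∷ x α ws) (sum-wordWeight-∷ x β ws) ⟩
    x · S + (y · S + 0ℚ)
      ≡⟨ solve 3 (λ x y S → x :* S :+ (y :* S :+ con 0ℚ) := (x :+ y) :* S) refl x y S ⟩
    (x + y) · S
      ≡⟨ cong ((x + y) ·_) (sum-wordWeight n (x · p)) ⟩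
    (x + y) · binomialProduct n (x · p) ∎
    where
    open ≡-Reasoning
    ws : List (List Kind)
    ws = words n
    Sα Sβ S : ℚ
    Sα = sumℚ (map (wordWeight x) (map (α ∷_) ws))
    Sβ = sumℚ (map (wordWeight x) (map (β ∷_) ws))
    S  = sumℚ (map (wordWeight (x · p)) ws)

s+k*c≤t+k*d⇒c≤d : ∀ k {s t c d} → s ℕ.+ k * c ≤ t ℕ.+ k * d → t < k ℕ.+ s → c ≤ d
s+k*c≤t+k*d⇒c≤d k {s} {t} {c} {d} le t<k+s =
  ℕ.s≤s⁻¹ (ℕ.*-cancelˡ-< k c (suc d) (ℕ.+-cancelˡ-< s _ _ (begin-strict
  s ℕ.+ k * c        ≤⟨ le ⟩
  t ℕ.+ k * d        <⟨ ℕ.+-monoˡ-< (k * d) t<k+s ⟩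
  k ℕ.+ s ℕ.+ k * d  ≡⟨ rearrange k s d ⟩
  s ℕ.+ k * suc d    ∎)))
  where
  open ℕ.≤-Reasoning
  rearrange : ∀ k s d → k ℕ.+ s ℕ.+ k * d ≡ s ℕ.+ k * suc d
  rearrange = solve-∀

t+k*d≤s+k*c⇒d<c : ∀ k {s t c d} → t ℕ.+ k * d ≤ s ℕ.+ k * c → s < t → d < c
t+k*d≤s+k*c⇒d<c k {s} {t} {c} {d} le s<t = ℕ.*-cancelˡ-< k d c (ℕ.+-cancelˡ-< s _ _ (begin-strict
  s ℕ.+ k * d  <⟨ ℕ.+-monoˡ-< (k * d) s<t ⟩
  t ℕ.+ k * d  ≤⟨ le ⟩
  s ℕ.+ k * c  ∎))
  where open ℕ.≤-Reasoning

residue-decomposition : ∀ k .{{_ : NonZero k}} {r x} → r ≤ k → 1 ≤ x → x % k ≡ r % k →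
                        ∃ λ c → x ≡ r ℕ.+ k * c
residue-decomposition k {r} {x} r≤k 1≤x x≡r with ℕ.m≤n⇒m<n∨m≡n r≤k
... | inj₁ r<k = x / k , (begin
  x                    ≡⟨ m≡m%n+[m/n]*n x k ⟩
  x % k ℕ.+ x / k * k  ≡⟨ cong₂ ℕ._+_ (trans x≡r (m<n⇒m%n≡m r<k)) (ℕ.*-comm (x / k) k) ⟩
  r ℕ.+ k * (x / k)    ∎)
  where open ≡-Reasoning
-- r = k is possible (when b = k); then r % k = 0 and x is a positive multiple of k.
... | inj₂ refl with x / k | trans (m≡m%n+[m/n]*n x k) (cong (ℕ._+ x / k * k) (trans x≡r (n%n≡0 k)))
...   | zero  | x≡0      = ⊥-elim (ℕ.<⇒≢ 1≤x (sym x≡0))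
...   | suc c | x≡[1+c]k = c , trans x≡[1+c]k (cong (k ℕ.+_) (ℕ.*-comm c k))

mult-accept : ∀ x {y} ys → y ≡ x → mult x (y ∷ ys) ≡ suc (mult x ys)
mult-accept x ys y≡x = cong length (List.filter-accept (ℕ._≟ x) y≡x)

mult-reject : ∀ x {y} ys → y ≢ x → mult x (y ∷ ys) ≡ mult x ys
mult-reject x ys y≢x = cong length (List.filter-reject (ℕ._≟ x) y≢x)

mult-none : ∀ x {ys} → All (_≢ x) ys → mult x ys ≡ 0
mult-none x ys≢x = cong length (List.filter-none (ℕ._≟ x) ys≢x)

mult-≤-∷ : ∀ x y ys → mult x ys ≤ mult x (y ∷ ys)
mult-≤-∷ x y ys with y ℕ.≟ x
... | yes y≡x = ℕ.≤-trans (ℕ.n≤1+n _) (ℕ.≤-reflexive (sym (mult-accept x ys y≡x)))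
... | no  y≢x = ℕ.≤-reflexive (sym (mult-reject x ys y≢x))

mult-repeated : ∀ x ys → 2 ≤ mult x (x ∷ x ∷ ys)
mult-repeated x ys =
  subst (2 ≤_) (sym (trans (mult-accept x (x ∷ ys) refl) (cong suc (mult-accept x ys refl))))
        (s≤s (s≤s z≤n))

ℓ-accept : ∀ k .{{_ : NonZero k}} r x xs → x % k ≡ r % k → ℓ k r (x ∷ xs) ≡ suc (ℓ k r xs)
ℓ-accept k r x xs x≡r = cong length (List.filter-accept (λ z → z % k ℕ.≟ r % k) x≡r)

ℓ-reject : ∀ k .{{_ : NonZero k}} r x xs → x % k ≢ r % k → ℓ k r (x ∷ xs) ≡ ℓ k r xs
ℓ-reject k r x xs x≢r = cong length (List.filter-reject (λ z → z % k ℕ.≟ r % k) x≢r)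

module Partitions (a b k : ℕ) .{{_ : NonZero k}} (1≤a : 1 ≤ a) (a<b : a < b) (b≤k : b ≤ k) where

  a≤b : a ≤ b
  a≤b = ℕ.<⇒≤ a<b

  residue : Kind → ℕ
  residue α = a
  residue β = b

  part : Kind → ℕ → ℕ
  part κ c = residue κ ℕ.+ k * c

  -- decode κ₀ w has smallest part residue κ₀ and, above it, parts of the kinds listed in w
  -- (largest first); the multiple of k in each of these counts the α's from it down to the
  -- end of w.
  decode : Kind → List Kind → List ℕ
  decode κ₀ []      = part κ₀ 0 ∷ []
  decode κ₀ (κ ∷ w) = part κ (index (κ ∷ w)) ∷ decode κ₀ w

  decodeWord : List Kind → List ℕ
  decodeWord []       = []
  decodeWord (κ₀ ∷ w) = decode κ₀ w

  part-zero : ∀ κ → part κ 0 ≡ residue κ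
  part-zero κ = trans (cong (residue κ ℕ.+_) (ℕ.*-zeroʳ k)) (ℕ.+-identityʳ (residue κ))

  part-suc : ∀ κ i → part κ (suc i) ≡ part κ i ℕ.+ k
  part-suc κ i = rearrange (residue κ) k i
    where
    rearrange : ∀ r k i → r ℕ.+ k * suc i ≡ r ℕ.+ k * i ℕ.+ k
    rearrange = solve-∀

  part-+k : ∀ κ i → part κ i ℕ.+ k ≡ (residue κ ℕ.+ k) ℕ.+ k * i
  part-+k κ i = rearrange (residue κ) k i
    where
    rearrange : ∀ r k i → r ℕ.+ k * i ℕ.+ k ≡ r ℕ.+ k ℕ.+ k * i
    rearrange = solve-∀

  offset : Kind → ℕ
  offset α = a ℕ.+ k
  offset β = b

  part-nextIndex : ∀ κ i → part κ (nextIndex κ i) ≡ offset κ ℕ.+ k * i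
  part-nextIndex α i = trans (part-suc α i) (part-+k α i)
  part-nextIndex β i = refl

  0<k : 0 < k
  0<k = ℕ.≤-trans 1≤a (ℕ.≤-trans a≤b b≤k)

  b<a+k : b < a ℕ.+ k
  b<a+k = ℕ.≤-<-trans b≤k (ℕ.m<n+m k 1≤a)

  residue≤b : ∀ κ → residue κ ≤ b
  residue≤b α = a≤b
  residue≤b β = ℕ.≤-refl

  residue≤offset : ∀ κ κ′ → residue κ′ ≤ offset κ
  residue≤offset α α = ℕ.m≤m+n a k
  residue≤offset α β = ℕ.<⇒≤ b<a+k
  residue≤offset β α = a≤b
  residue≤offset β β = ℕ.≤-refl

  offset≤residue+k : ∀ κ κ′ → offset κ ≤ residue κ′ ℕ.+ k
  offset≤residue+k α α = ℕ.≤-refl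
  offset≤residue+k α β = ℕ.+-monoˡ-≤ k a≤b
  offset≤residue+k β α = ℕ.<⇒≤ b<a+k
  offset≤residue+k β β = ℕ.m≤m+n b k

  offset<b+k : ∀ κ → offset κ < b ℕ.+ k
  offset<b+k α = ℕ.+-monoˡ-< k a<b
  offset<b+k β = ℕ.m<m+n b 0<k

  part-% : ∀ κ c → part κ c % k ≡ residue κ % k
  part-% κ c =
    trans (cong (λ z → (residue κ ℕ.+ z) % k) (ℕ.*-comm k c)) ([m+kn]%n≡m%n (residue κ) c k)

  a%k≢b%k : a % k ≢ b % k
  a%k≢b%k a≡b with ℕ.m≤n⇒m<n∨m≡n b≤k
  ... | inj₁ b<k = ℕ.<⇒≢ a<b (begin
    a      ≡⟨ m<n⇒m%n≡m (ℕ.<-trans a<b b<k) ⟨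
    a % k  ≡⟨ a≡b ⟩
    b % k  ≡⟨ m<n⇒m%n≡m b<k ⟩
    b      ∎)
    where open ≡-Reasoning
  ... | inj₂ refl = ℕ.<⇒≢ 1≤a (sym (trans (sym (m<n⇒m%n≡m a<b)) (trans a≡b (n%n≡0 b))))

  kind-of-part : ∀ κ c κ′ → part κ c % k ≡ residue κ′ % k → κ ≡ κ′
  kind-of-part α c α _ = refl
  kind-of-part α c β e = ⊥-elim (a%k≢b%k (trans (sym (part-% α c)) e))
  kind-of-part β c α e = ⊥-elim (a%k≢b%k (trans (sym e) (part-% β c)))
  kind-of-part β c β _ = refl

  part-≤-above : ∀ κ κ′ i → part κ′ i ≤ part κ (nextIndex κ i)
  part-≤-above κ κ′ i =
    subst (part κ′ i ≤_) (sym (part-nextIndex κ i)) (ℕ.+-monoˡ-≤ (k * i) (residue≤offset κ κ′))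

  gap-above : ∀ κ κ′ i → Gap k b (part κ (nextIndex κ i)) (part κ′ i)
  gap-above κ κ′ i = subst₂ _≤_ (sym (part-nextIndex κ i)) (sym (part-+k κ′ i))
                       (ℕ.+-monoˡ-≤ (k * i) (offset≤residue+k κ κ′))
                   , strict κ′
    where
    strict : ∀ κ′ → Cong k (part κ′ i) b → part κ (nextIndex κ i) < part κ′ i ℕ.+ k
    strict α α≡b = ⊥-elim (a%k≢b%k (trans (sym (part-% α i)) α≡b))
    strict β _   = subst₂ _<_ (sym (part-nextIndex κ i)) (sym (part-+k β i))
                     (ℕ.+-monoˡ-< (k * i) (offset<b+k κ))

  decode-all : ∀ {P : ℕ → Set} → (∀ κ c → P (part κ c)) → ∀ κ₀ w → All P (decode κ₀ w)
  decode-all P-part κ₀ []      = P-part κ₀ 0 ∷ []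
  decode-all P-part κ₀ (κ ∷ w) = P-part κ _ ∷ decode-all P-part κ₀ w

  decode-linked : ∀ {R : ℕ → ℕ → Set} → (∀ κ κ′ i → R (part κ (nextIndex κ i)) (part κ′ i)) →
                  ∀ κ₀ w → Linked R (decode κ₀ w)
  decode-linked R-above κ₀ []           = [-]
  decode-linked R-above κ₀ (κ ∷ [])     = R-above κ κ₀ 0 ∷ [-]
  decode-linked R-above κ₀ (κ ∷ κ′ ∷ w) =
    R-above κ κ′ (index (κ′ ∷ w)) ∷ decode-linked R-above κ₀ (κ′ ∷ w)

  nextIndex-≥ : ∀ κ i → i ≤ nextIndex κ i
  nextIndex-≥ α i = ℕ.n≤1+n i
  nextIndex-≥ β i = ℕ.≤-refl

  decode-≤ : ∀ κ₀ w → All (_≤ b ℕ.+ k * index w) (decode κ₀ w)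
  decode-≤ κ₀ []      = ℕ.+-monoˡ-≤ (k * 0) (residue≤b κ₀) ∷ []
  decode-≤ κ₀ (κ ∷ w) = ℕ.+-monoˡ-≤ _ (residue≤b κ)
    ∷ All.map (λ x≤ → ℕ.≤-trans x≤ (ℕ.+-monoʳ-≤ b (ℕ.*-monoʳ-≤ k (nextIndex-≥ κ (index w)))))
              (decode-≤ κ₀ w)

  mult-decode : ∀ κ₀ w x → Cong k x a → mult x (decode κ₀ w) ≤ 1
  mult-decode κ₀ []      x _ = List.length-filter (ℕ._≟ x) (part κ₀ 0 ∷ [])
  mult-decode κ₀ (κ ∷ w) x x≡a with part κ (index (κ ∷ w)) ℕ.≟ x
  ... | no top≢x = subst (_≤ 1) (sym (mult-reject x (decode κ₀ w) top≢x)) (mult-decode κ₀ w x x≡a)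
  mult-decode κ₀ (β ∷ w) x x≡a | yes refl = ⊥-elim (a%k≢b%k (trans (sym x≡a) (part-% β _)))
  mult-decode κ₀ (α ∷ w) x x≡a | yes refl =
    ℕ.≤-reflexive (trans (mult-accept x (decode κ₀ w) refl)
                         (cong suc (mult-none x (All.map below (decode-≤ κ₀ w)))))
    where
    below : ∀ {y} → y ≤ b ℕ.+ k * index w → y ≢ x
    below y≤ refl = ℕ.<⇒≱ (subst (b ℕ.+ k * index w <_) (sym (part-nextIndex α (index w)))
                             (ℕ.+-monoˡ-< (k * index w) b<a+k)) y≤

  1≤residue : ∀ κ → 1 ≤ residue κ
  1≤residue α = 1≤a
  1≤residue β = ℕ.≤-trans 1≤a a≤b

  part-a-or-b : ∀ κ c → Cong k (part κ c) a ⊎ Cong k (part κ c) b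
  part-a-or-b α c = inj₁ (part-% α c)
  part-a-or-b β c = inj₂ (part-% β c)

  length-decode : ∀ κ₀ w → length (decode κ₀ w) ≡ suc (length w)
  length-decode κ₀ []      = refl
  length-decode κ₀ (κ ∷ w) = cong suc (length-decode κ₀ w)

  last-decode : ∀ κ₀ w → last (decode κ₀ w) ≡ just (residue κ₀)
  last-decode κ₀ []           = cong just (part-zero κ₀)
  last-decode κ₀ (κ ∷ [])     = cong just (part-zero κ₀)
  last-decode κ₀ (κ ∷ κ′ ∷ w) = last-decode κ₀ (κ′ ∷ w)

  last-a-or-b : ∀ κ₀ w → last (decode κ₀ w) ≡ just a ⊎ last (decode κ₀ w) ≡ just b
  last-a-or-b α w = inj₁ (last-decode α w)
  last-a-or-b β w = inj₂ (last-decode β w)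

  decode-BR' : ∀ κ₀ w → BR' a b k (suc (length w)) (decode κ₀ w)
  decode-BR' κ₀ w =
      ( decode-all (λ κ c → ℕ.≤-trans (1≤residue κ) (ℕ.m≤m+n _ _)) κ₀ w
      , decode-linked part-≤-above κ₀ w )
    , length-decode κ₀ w
    , decode-all part-a-or-b κ₀ w
    , mult-decode κ₀ w
    , last-a-or-b κ₀ w
    , decode-linked gap-above κ₀ w

  index-above : ∀ κ κ′ {c i} → part κ′ i ≤ part κ c → Gap k b (part κ c) (part κ′ i) →
                (Cong k (part κ c) a → part κ c ≢ part κ′ i) → c ≡ nextIndex κ i
  index-above α α {c} {i} le (gap , _) distinct =
    ℕ.≤-antisym c≤1+i (ℕ.≤∧≢⇒< i≤c (λ i≡c → distinct (part-% α c) (cong (part α) (sym i≡c))))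
    where
    i≤c : i ≤ c
    i≤c = s+k*c≤t+k*d⇒c≤d k le (ℕ.m<n+m a 0<k)
    c≤1+i : c ≤ suc i
    c≤1+i = s+k*c≤t+k*d⇒c≤d k (subst (part α c ≤_) (sym (part-suc α i)) gap) (ℕ.m<n+m a 0<k)
  index-above α β {c} {i} le (_ , gap) _ = ℕ.≤-antisym c≤1+i i<c
    where
    i<c : i < c
    i<c = t+k*d≤s+k*c⇒d<c k le a<b
    c≤1+i : c ≤ suc i
    c≤1+i = s+k*c≤t+k*d⇒c≤d k (subst (part α c <_) (sym (part-suc β i)) (gap (part-% β i)))
                      (ℕ.≤-<-trans b≤k (ℕ.m<m+n k (s≤s z≤n)))
  index-above β α {c} {i} le (gap , _) _ = ℕ.≤-antisym c≤i i≤c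
    where
    i≤c : i ≤ c
    i≤c = s+k*c≤t+k*d⇒c≤d k le (ℕ.≤-<-trans b≤k (ℕ.m<m+n k 1≤a))
    c≤i : c ≤ i
    c≤i = s+k*c≤t+k*d⇒c≤d k (subst (part β c ≤_) (part-+k α i) gap)
                    (subst (a ℕ.+ k <_) (ℕ.+-comm b k) (ℕ.+-monoˡ-< k a<b))
  index-above β β {c} {i} le (_ , gap) _ = ℕ.≤-antisym c≤i i≤c
    where
    i≤c : i ≤ c
    i≤c = s+k*c≤t+k*d⇒c≤d k le (ℕ.m<n+m b 0<k)
    c≤i : c ≤ i
    c≤i = s+k*c≤t+k*d⇒c≤d k (subst (part β c <_) (part-+k β i) (gap (part-% β i)))
                    (subst (_< k ℕ.+ suc b) (ℕ.+-comm k b) (ℕ.+-monoʳ-< k (ℕ.n<1+n b)))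

  part-decomposition : ∀ {x} → 1 ≤ x → Cong k x a ⊎ Cong k x b → ∃₂ λ κ c → x ≡ part κ c
  part-decomposition 1≤x (inj₁ x≡a) = α , residue-decomposition k (ℕ.≤-trans a≤b b≤k) 1≤x x≡a
  part-decomposition 1≤x (inj₂ x≡b) = β , residue-decomposition k b≤k 1≤x x≡b

  BR'-tail : ∀ {n x y r} → BR' a b k (suc (suc n)) (x ∷ y ∷ r) → BR' a b k (suc n) (y ∷ r)
  BR'-tail {x = x} {y} {r}
    ((_ ∷ positive , _ ∷ sorted) , len , _ ∷ residues , mult≤1 , last≡ , _ ∷ gaps) =
    (positive , sorted) , ℕ.suc-injective len , residues ,
    (λ z z≡a → ℕ.≤-trans (mult-≤-∷ z x (y ∷ r)) (mult≤1 z z≡a)) , last≡ , gaps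

  BR'-head : ∀ {n x y r} → BR' a b k (suc (suc n)) (x ∷ y ∷ r) →
             ∀ κ′ i → y ≡ part κ′ i → ∃ λ κ → x ≡ part κ (nextIndex κ i)
  BR'-head {r = r} ((1≤x ∷ _ , y≤x ∷ _) , _ , x-residue ∷ _ , mult≤1 , _ , gap ∷ _) κ′ i refl
    with part-decomposition 1≤x x-residue
  ... | κ , c , refl = κ , cong (part κ) (index-above κ κ′ y≤x gap distinct)
    where
    distinct : Cong k (part κ c) a → part κ c ≢ part κ′ i
    distinct x≡a x≡y = ℕ.<⇒≱ (s≤s (mult≤1 _ x≡a))
      (subst (λ y → 2 ≤ mult (part κ c) (part κ c ∷ y ∷ r)) x≡y (mult-repeated (part κ c) r))

  smallest-part : ∀ {x} → just x ≡ just a ⊎ just x ≡ just b → ∃ λ κ₀ → x ∷ [] ≡ decode κ₀ []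
  smallest-part (inj₁ x≡a) = α , cong (_∷ []) (trans (just-injective x≡a) (sym (part-zero α)))
  smallest-part (inj₂ x≡b) = β , cong (_∷ []) (trans (just-injective x≡b) (sym (part-zero β)))

  decode-head : ∀ κ₀ w → ∃₂ λ κ rest → decode κ₀ w ≡ part κ (index w) ∷ rest
  decode-head κ₀ []      = κ₀ , [] , refl
  decode-head κ₀ (κ ∷ w) = κ , decode κ₀ w , refl

  decode-complete : ∀ n {λs} → BR' a b k (suc n) λs → ∃₂ λ κ₀ w → length w ≡ n × λs ≡ decode κ₀ w
  decode-complete n       {[]}    (_ , () , _)
  decode-complete n       {x ∷ []} (_ , len , _ , _ , last≡ , _) with smallest-part last≡
  ... | κ₀ , x∷[]≡ = κ₀ , [] , ℕ.suc-injective len , x∷[]≡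
  decode-complete zero    {x ∷ y ∷ r} (_ , () , _)
  decode-complete (suc n) {x ∷ y ∷ r} br with decode-complete n (BR'-tail br)
  ... | κ₀ , w , len , y∷r≡ with decode-head κ₀ w
  ...   | κ′ , _ , top≡ with BR'-head br κ′ (index w) (List.∷-injectiveˡ (trans y∷r≡ top≡))
  ...     | κ , x≡ = κ₀ , κ ∷ w , cong suc len , cong₂ _∷_ x≡ y∷r≡

  decode≢[] : ∀ κ₀ w → decode κ₀ w ≢ []
  decode≢[] κ₀ []      ()
  decode≢[] κ₀ (κ ∷ w) ()

  decode-injective : ∀ {κ₀ κ₀′} w w′ → decode κ₀ w ≡ decode κ₀′ w′ → κ₀ ≡ κ₀′ × w ≡ w′
  decode-injective {κ₀} {κ₀′} [] [] e =
    kind-of-part κ₀ 0 κ₀′ (trans (cong (_% k) (List.∷-injectiveˡ e)) (part-% κ₀′ 0)) , refl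
  decode-injective []      (_ ∷ w′) e = ⊥-elim (decode≢[] _ w′ (sym (List.∷-injectiveʳ e)))
  decode-injective (_ ∷ w) []       e = ⊥-elim (decode≢[] _ w (List.∷-injectiveʳ e))
  decode-injective (κ ∷ w) (κ′ ∷ w′) e with decode-injective w w′ (List.∷-injectiveʳ e)
  ... | κ₀≡κ₀′ , refl =
    κ₀≡κ₀′ ,
    cong (_∷ w) (kind-of-part κ _ κ′ (trans (cong (_% k) (List.∷-injectiveˡ e)) (part-% κ′ _)))

  decodeWord-injective : ∀ {w w′} → decodeWord w ≡ decodeWord w′ → w ≡ w′
  decodeWord-injective {[]}     {[]}       _ = refl
  decodeWord-injective {[]}     {κ₀ ∷ w′}  e = ⊥-elim (decode≢[] κ₀ w′ (sym e))
  decodeWord-injective {κ₀ ∷ w} {[]}       e = ⊥-elim (decode≢[] κ₀ w e)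
  decodeWord-injective {κ₀ ∷ w} {κ₀′ ∷ w′} e with decode-injective w w′ e
  ... | refl , refl = refl

  enumeration : ℕ → List (List ℕ)
  enumeration n = map decodeWord (words (suc n))

  enumeration-unique : ∀ n → Unique (enumeration n)
  enumeration-unique n = Unique.map⁺ decodeWord-injective (words-unique (suc n))

  ∈-enumeration : ∀ n λs → λs ∈ enumeration n ⇔ BR' a b k (suc n) λs
  ∈-enumeration n λs = mk⇔ sound complete
    where
    sound : λs ∈ enumeration n → BR' a b k (suc n) λs
    sound λs∈ with ∈-map⁻ decodeWord λs∈
    ... | [] , w∈ , _ with () ← length-∈-words (suc n) w∈
    ... | κ₀ ∷ w , w∈ , refl = subst (λ l → BR' a b k (suc l) (decode κ₀ w))
                                     (ℕ.suc-injective (length-∈-words (suc n) w∈)) (decode-BR' κ₀ w)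
    complete : BR' a b k (suc n) λs → λs ∈ enumeration n
    complete br with decode-complete n br
    ... | κ₀ , w , refl , refl = ∈-map⁺ decodeWord (∈-words (κ₀ ∷ w))

  module Weights (u v q : ℚ) where

    p y x₀ : ℚ
    p  = q ^ℚ k
    y  = v · q ^ℚ b
    x₀ = u · q ^ℚ a

    wt : List ℕ → ℚ
    wt = weight a b k u v q

    open WordWeight p y using (letter; wordWeight; letter-shift; wordWeight-shift; sum-wordWeight)
    open QBinomial p y using (binomialProduct)

    weight-cons : ∀ κ c xs → wt (part κ c ∷ xs) ≡ letter x₀ κ · p ^ℚ c · wt xs
    weight-cons α c xs
      rewrite ℓ-accept k a (part α c) xs (part-% α c)
            | ℓ-reject k b (part α c) xs (λ α≡b → a%k≢b%k (trans (sym (part-% α c)) α≡b))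
            | ^ℚ-+ q (part α c) (size xs) | ^ℚ-+ q a (k * c) | ^ℚ-* q k c =
      solve 6 (λ u Qa P U V S → u :* U :* V :* (Qa :* P :* S) := u :* Qa :* P :* (U :* V :* S))
        refl u (q ^ℚ a) (p ^ℚ c) (u ^ℚ ℓ k a xs) (v ^ℚ ℓ k b xs) (q ^ℚ size xs)
    weight-cons β c xs
      rewrite ℓ-reject k a (part β c) xs (λ β≡a → a%k≢b%k (trans (sym β≡a) (part-% β c)))
            | ℓ-accept k b (part β c) xs (part-% β c)
            | ^ℚ-+ q (part β c) (size xs) | ^ℚ-+ q b (k * c) | ^ℚ-* q k c =
      solve 6 (λ v Qb P U V S → U :* (v :* V) :* (Qb :* P :* S) := v :* Qb :* P :* (U :* V :* S))
        refl v (q ^ℚ b) (p ^ℚ c) (u ^ℚ ℓ k a xs) (v ^ℚ ℓ k b xs) (q ^ℚ size xs)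

    weight-decode : ∀ κ₀ w → wt (decode κ₀ w) ≡ letter x₀ κ₀ · wordWeight (x₀ · p) w
    weight-decode κ₀ []      = trans (weight-cons κ₀ 0 []) (ℚ.*-identityʳ (letter x₀ κ₀ · 1ℚ))
    weight-decode κ₀ (κ ∷ w) = begin
      wt (part κ (nextIndex κ (index w)) ∷ decode κ₀ w)
        ≡⟨ weight-cons κ _ (decode κ₀ w) ⟩
      letter x₀ κ · p ^ℚ nextIndex κ (index w) · wt (decode κ₀ w)
        ≡⟨ cong₂ (λ s t → s · t) (letter-shift x₀ κ (index w)) (weight-decode κ₀ w) ⟩
      letter (x₀ · p) κ · p ^ℚ index w · (letter x₀ κ₀ · W)
        ≡⟨ solve 4 (λ L P L₀ W → L :* P :* (L₀ :* W) := L₀ :* (L :* (P :* W))) refl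
             (letter (x₀ · p) κ) (p ^ℚ index w) (letter x₀ κ₀) W ⟩
      letter x₀ κ₀ · (letter (x₀ · p) κ · (p ^ℚ index w · W))
        ≡⟨ cong (λ t → letter x₀ κ₀ · (letter (x₀ · p) κ · t)) (wordWeight-shift (x₀ · p) w) ⟨
      letter x₀ κ₀ · wordWeight (x₀ · p) (κ ∷ w) ∎
      where
      open ≡-Reasoning
      W : ℚ
      W = wordWeight (x₀ · p) w

    weight-decodeWord : ∀ w → wt (decodeWord w) ≡ wordWeight x₀ w
    weight-decodeWord []       = refl
    weight-decodeWord (κ₀ ∷ w) = weight-decode κ₀ w

    sum-weight-enumeration : ∀ n → sumℚ (map wt (enumeration n)) ≡ binomialProduct (suc n) x₀
    sum-weight-enumeration n = begin
      sumℚ (map wt (map decodeWord ws))  ≡⟨ cong sumℚ (List.map-∘ ws) ⟨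
      sumℚ (map (wt ∘ decodeWord) ws)    ≡⟨ cong sumℚ (List.map-cong weight-decodeWord ws) ⟩
      sumℚ (map (wordWeight x₀) ws)      ≡⟨ sum-wordWeight (suc n) x₀ ⟩
      binomialProduct (suc n) x₀         ∎
      where
      open ≡-Reasoning
      ws : List (List Kind)
      ws = words (suc n)

rhsExp≡ : ∀ {a b m h} k → a ≤ b → h ≤ m →
          rhsExp a b k m h ≡ a * h ℕ.+ b * (m ∸ h) ℕ.+ k * (h C 2)
rhsExp≡ {a} {b} {m} {h} k a≤b h≤m = trans (cong (_∸ d * h) split) (ℕ.m+n∸m≡n (d * h) _)
  where
  d e t : ℕ
  d = b ∸ a
  e = m ∸ h
  t = k * (h C 2)
  split : m * b ℕ.+ t ≡ d * h ℕ.+ (a * h ℕ.+ b * e ℕ.+ t)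
  split = begin
    m * b ℕ.+ t
      ≡⟨ cong₂ (λ m b → m * b ℕ.+ t) (ℕ.m+[n∸m]≡n h≤m) (ℕ.m+[n∸m]≡n a≤b) ⟨
    (h ℕ.+ e) * (a ℕ.+ d) ℕ.+ t
      ≡⟨ rearrange a d h e t ⟩
    d * h ℕ.+ (a * h ℕ.+ (a ℕ.+ d) * e ℕ.+ t)
      ≡⟨ cong (λ b → d * h ℕ.+ (a * h ℕ.+ b * e ℕ.+ t)) (ℕ.m+[n∸m]≡n a≤b) ⟩
    d * h ℕ.+ (a * h ℕ.+ b * e ℕ.+ t) ∎
    where
    open ≡-Reasoning
    rearrange : ∀ a d h e t →
                (h ℕ.+ e) * (a ℕ.+ d) ℕ.+ t ≡ d * h ℕ.+ (a * h ℕ.+ (a ℕ.+ d) * e ℕ.+ t)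
    rearrange = solve-∀

rhs≡binomialSum : ∀ a b k m u v q → a ≤ b → (∀ i → 1 ≤ i → i ≤ m → q ^ℚ (k * i) ≢ 1ℚ) →
  rhs a b k m u v q
    ≡ ∑[ h < suc m ] QBinomial.binomialTerm (q ^ℚ k) (v · q ^ℚ b) m (u · q ^ℚ a) (toℕ h)
rhs≡binomialSum a b k m u v q a≤b q^ki≢1 =
  trans (sumℚ-map-applyUpTo (suc m) id summand)
        (sum-cong-≗ {suc m} (λ h → term (toℕ h) (ℕ.s≤s⁻¹ (toℕ<n h))))
  where
  open QBinomial (q ^ℚ k) (v · q ^ℚ b) using (binomialTerm)
  p : ℚ
  p = q ^ℚ k
  summand : ℕ → ℚ
  summand h = u ^ℚ h · v ^ℚ (m ∸ h) · q ^ℚ rhsExp a b k m h · qbinom k q m h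
  term : ∀ h → h ≤ m → summand h ≡ binomialTerm m (u · q ^ℚ a) h
  term h h≤m
    rewrite qbinom≡gaussian k q (λ i 1≤i i≤m → q^ki≢1 i 1≤i i≤m ∘ trans (^ℚ-* q k i)) h≤m
          | rhsExp≡ k a≤b h≤m
          | ^ℚ-+ q (a * h ℕ.+ b * (m ∸ h)) (k * (h C 2)) | ^ℚ-+ q (a * h) (b * (m ∸ h))
          | ^ℚ-* q a h | ^ℚ-* q b (m ∸ h) | ^ℚ-* q k (h C 2)
          | ^ℚ-distrib-· u (q ^ℚ a) h | ^ℚ-distrib-· v (q ^ℚ b) (m ∸ h) =
    solve 6 (λ U V A B P G → U :* V :* (A :* B :* P) :* G := U :* A :* P :* (V :* B :* G)) refl
      (u ^ℚ h) (v ^ℚ (m ∸ h)) ((q ^ℚ a) ^ℚ h) ((q ^ℚ b) ^ℚ (m ∸ h)) (p ^ℚ (h C 2)) (gaussian p m h)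

mainTheorem12 : (a b k : ℕ) .{{_ : NonZero k}} → 1 ≤ a → a < b → b ≤ k →
    (m : ℕ) → 1 ≤ m →
    (L : List (List ℕ)) → Unique L → (∀ λs → (λs ∈ L) ⇔ BR' a b k m λs) →
    (u v q : ℚ) → (∀ i → 1 ≤ i → i ≤ m → q ^ℚ (k * i) ≢ 1ℚ) →
    sumℚ (map (weight a b k u v q) L) ≡ rhs a b k m u v q
mainTheorem12 a b k 1≤a a<b b≤k (suc n) _ L L-unique L⇔BR' u v q q^ki≢1 = begin
  sumℚ (map (weight a b k u v q) L)
    ≡⟨ sumℚ-map-unique (weight a b k u v q) L-unique (enumeration-unique n)
         (λ λs → ⇔-sym (∈-enumeration n λs) ⇔-∘ L⇔BR' λs) ⟩
  sumℚ (map (weight a b k u v q) (enumeration n))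
    ≡⟨ sum-weight-enumeration n ⟩
  binomialProduct (suc n) (u · q ^ℚ a)
    ≡⟨ q-binomial (suc n) (u · q ^ℚ a) ⟩
  ∑[ h < suc (suc n) ] binomialTerm (suc n) (u · q ^ℚ a) (toℕ h)
    ≡⟨ rhs≡binomialSum a b k (suc n) u v q (ℕ.<⇒≤ a<b) q^ki≢1 ⟨
  rhs a b k (suc n) u v q ∎
  where
  open ≡-Reasoning
  open Partitions a b k 1≤a a<b b≤k
  open Weights u v q
  open QBinomial (q ^ℚ k) (v · q ^ℚ b)
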